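{- Let $k\ge 2$, let $C$ be an $\mathbb{F}_{q^m}$-$[mk,k,m]$ simplex rank-metric code (that is, a non-degenerate $\mathbb{F}_{q^m}$-$[mk,k]$ rank-metric code), and let $\mathcal{M}=\mathcal{M}[C]$ be the associated $q$-matroid. Then $\operatorname{crit}(\mathcal{M})=k$.
   Context: $q$ is a prime power, $m\ge2$. An $\mathbb{F}_{q^m}$-$[n,k]$ rank-metric (vector) code is a $k$-dimensional $\mathbb{F}_{q^m}$-subspace $C\le\mathbb{F}_{q^m}^n$. Fix an $\mathbb{F}_q$-basis $\Gamma$ of $\mathbb{F}_{q^m}$; for $x\in\mathbb{F}_{q^m}^n$, $\Gamma(x)\in\mathbb{F}_q^{n\times m}$ has $i$-th row the coordinates of $x_i$, and $\operatorname{supp}(x)$ is the column space of $\Gamma(x)$. $C$ is non-degenerate if $\sum_{x\in C}\operatorname{supp}(x)=\mathbb{F}_q^n$. The critical exponent $\operatorname{crit}(\mathcal{M}[C])$ is the least positive integer $t$ such that there exist $x_1,\ldots,x_t\in C$ with $\sum_{i=1}^t\operatorname{supp}(x_i)=\mathbb{F}_q^n$. -}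

module Defs where

open import Level using (Level; _⊔_)
open import Algebra.Bundles using (CommutativeRing)
open import Data.Nat using (ℕ; _≤_; _^_) renaming (zero to nzero; suc to nsuc)
open import Data.Nat.Primality using (Prime)
open import Data.Fin using (Fin) renaming (zero to fzero; suc to fsuc)
open import Data.Product using (Σ; ∃; _×_)
open import Relation.Nullary using (¬_)
open import Relation.Binary.PropositionalEquality as ≡ using (_≡_)
open import Function.Bundles using (Inverse)

IsPrimePower : ℕ → Set
IsPrimePower q = Σ ℕ λ p → Σ ℕ λ e → Prime p × 1 ≤ e × q ≡ p ^ e

module _ {c ℓ} (R : CommutativeRing c ℓ) where
  open CommutativeRing R using (Carrier; _≈_; _+_; _*_; 0#; 1#; setoid)

  ∑ : ∀ {n} → (Fin n → Carrier) → Carrier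
  ∑ {nzero}  f = 0#
  ∑ {nsuc n} f = f fzero + ∑ (λ i → f (fsuc i))

  record IsField : Set (c ⊔ ℓ) where
    field
      0≉1     : ¬ (0# ≈ 1#)
      inverse : ∀ x → ¬ (x ≈ 0#) → Σ Carrier λ y → x * y ≈ 1#

  HasCard : ℕ → Set (c ⊔ ℓ)
  HasCard q = Inverse setoid (≡.setoid (Fin q))

  RowsIndependent : ∀ {k n} → (Fin k → Fin n → Carrier) → Set (c ⊔ ℓ)
  RowsIndependent {k} {n} G =
    (u : Fin k → Carrier) → (∀ i → ∑ (λ r → u r * G r i) ≈ 0#) → ∀ r → u r ≈ 0#

  InRowSpace : ∀ {k n} → (Fin k → Fin n → Carrier) → (Fin n → Carrier) → Set (c ⊔ ℓ)
  InRowSpace {k} {n} G x = Σ (Fin k → Carrier) λ u → ∀ i → x i ≈ ∑ (λ r → u r * G r i)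

-- E is a degree-m field extension of F, with a fixed F-basis Γ of E and
-- the associated coordinate map.
record Extension {c ℓ c' ℓ'} (F : CommutativeRing c ℓ) (E : CommutativeRing c' ℓ')
                 (m : ℕ) : Set (c ⊔ ℓ ⊔ c' ⊔ ℓ') where
  private
    module F = CommutativeRing F
    module E = CommutativeRing E
  field
    ι      : F.Carrier → E.Carrier
    ι-cong : ∀ {a b} → a F.≈ b → ι a E.≈ ι b
    ι-+    : ∀ a b → ι (a F.+ b) E.≈ ι a E.+ ι b
    ι-*    : ∀ a b → ι (a F.* b) E.≈ ι a E.* ι b
    ι-1    : ι F.1# E.≈ E.1#
    Γ      : Fin m → E.Carrier
    coord  : E.Carrier → Fin m → F.Carrier
    expand : ∀ x → x E.≈ ∑ E (λ j → ι (coord x j) E.* Γ j)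
    indep  : (a : Fin m → F.Carrier) → ∑ E (λ j → ι (a j) E.* Γ j) E.≈ E.0# →
             ∀ j → a j F.≈ F.0#

module _ {c ℓ c' ℓ'} {F : CommutativeRing c ℓ} {E : CommutativeRing c' ℓ'} {m : ℕ}
         (X : Extension F E m) where
  private
    module F = CommutativeRing F
    module E = CommutativeRing E
  open Extension X

  Γmat : ∀ {n} → (Fin n → E.Carrier) → Fin n → Fin m → F.Carrier
  Γmat x i j = coord (x i) j

  supp : ∀ {n} → (Fin n → E.Carrier) → (Fin n → F.Carrier) → Set (c ⊔ ℓ)
  supp {n} x v = Σ (Fin m → F.Carrier) λ a → ∀ i → v i F.≈ ∑ F (λ j → a j F.* Γmat x i j)

  SuppsSpan : ∀ {n t} → (Fin t → Fin n → E.Carrier) → Set (c ⊔ ℓ)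
  SuppsSpan {n} {t} xs = (v : Fin n → F.Carrier) →
    Σ (Fin t → Fin n → F.Carrier) λ w →
      (∀ s → supp (xs s) (w s)) × (∀ i → v i F.≈ ∑ F (λ s → w s i))

  SpannedBy : ∀ {k n} → (Fin k → Fin n → E.Carrier) → ℕ → Set (c ⊔ ℓ ⊔ c' ⊔ ℓ')
  SpannedBy {k} {n} G t = Σ (Fin t → Fin n → E.Carrier) λ xs →
    (∀ s → InRowSpace E G (xs s)) × SuppsSpan xs

  -- non-degenerate: the sum of all supports of codewords is F^n
  -- (elements of a sum of subspaces are finite sums)
  NonDegenerate : ∀ {k n} → (Fin k → Fin n → E.Carrier) → Set (c ⊔ ℓ ⊔ c' ⊔ ℓ')
  NonDegenerate G = Σ ℕ λ t → SpannedBy G t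

  -- crit(M[C]) = t : t is the least positive integer with t codewords whose supports span F^n
  CritIs : ∀ {k n} → (Fin k → Fin n → E.Carrier) → ℕ → Set (c ⊔ ℓ ⊔ c' ⊔ ℓ')
  CritIs G t = 1 ≤ t × SpannedBy G t × (∀ s → 1 ≤ s → SpannedBy G s → t ≤ s)

{-# OPTIONS --safe #-}
module Submission where

open import Defs
open import Algebra.Bundles using (CommutativeRing)
open import Data.Nat using (ℕ; _≤_; zero; suc; _^_; s≤s; z≤n)
open import Data.Nat.Properties using (≤-trans; ^-*-assoc; *-monoʳ-<; ^-monoʳ-<; <⇒≱; ≮⇒≥)
open import Data.Fin using (Fin; funToFin; finToFun; combine) renaming (zero to fzero; suc to fsuc)
open import Data.Fin.Properties using (funToFin-finToFin; finToFun-funToFin; injective⇒≤)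
open import Data.Product using (Σ; _×_; _,_; proj₁; proj₂)
open import Relation.Nullary using (¬_)
open import Function using (_∘_; Inverse)
open import Data.Empty using (⊥-elim)
open import Relation.Binary.PropositionalEquality as ≡ using (_≡_; _≗_)

-- The rows g_r of G are codewords, and every codeword x = ∑ u_r g_r has
-- supp(x) ⊆ ∑ supp(g_r), because multiplication by u_r acts on the
-- F-coordinates of E as an F-linear map.  So whenever some codeword supports
-- span Fⁿ (non-degeneracy), the k row supports already do, and crit ≤ k.
-- Conversely, each support is the column space of an n × m matrix, so s
-- supports spanning Fⁿ = F^{mk} give an F-linear surjection F^{ms} → F^{mk},
-- hence q^{mk} ≤ q^{ms} and k ≤ s.

funToFin-cong : ∀ {a b} {f g : Fin a → Fin b} → f ≗ g → funToFin f ≡ funToFin g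
funToFin-cong {zero}  e = ≡.refl
funToFin-cong {suc a} e = ≡.cong₂ combine (e fzero) (funToFin-cong (e ∘ fsuc))

funToFin-injective : ∀ {a b} {f g : Fin a → Fin b} → funToFin f ≡ funToFin g → f ≗ g
funToFin-injective {f = f} {g} e i = begin
  f i                          ≡⟨ finToFun-funToFin f i ⟨
  finToFun (funToFin f) i      ≡⟨ ≡.cong (λ z → finToFun z i) e ⟩
  finToFun (funToFin g) i      ≡⟨ finToFun-funToFin g i ⟩
  g i                          ∎
  where open ≡.≡-Reasoning

module Sums {c ℓ} (R : CommutativeRing c ℓ) where
  open CommutativeRing R
  open import Relation.Binary.Reasoning.Setoid setoid
  import Algebra.Properties.Semiring.Sum semiring as S
  import Algebra.Properties.Ring ring as RP

  ∑≡sum : ∀ {n} (f : Fin n → Carrier) → ∑ R f ≡ S.sum f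
  ∑≡sum {zero}  f = ≡.refl
  ∑≡sum {suc n} f = ≡.cong (f fzero +_) (∑≡sum (f ∘ fsuc))

  ∑-cong : ∀ {n} {f g : Fin n → Carrier} → (∀ i → f i ≈ g i) → ∑ R f ≈ ∑ R g
  ∑-cong {zero}  e = refl
  ∑-cong {suc n} e = +-cong (e fzero) (∑-cong (e ∘ fsuc))

  ∑-zero : ∀ n → ∑ R {n} (λ _ → 0#) ≈ 0#
  ∑-zero n = trans (reflexive (∑≡sum {n} (λ _ → 0#))) (S.sum-replicate-zero n)

  ∑-distrib-+ : ∀ {n} (f g : Fin n → Carrier) → ∑ R (λ i → f i + g i) ≈ ∑ R f + ∑ R g
  ∑-distrib-+ f g = begin
    ∑ R (λ i → f i + g i)    ≡⟨ ∑≡sum (λ i → f i + g i) ⟩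
    S.sum (λ i → f i + g i)  ≈⟨ S.∑-distrib-+ f g ⟩
    S.sum f + S.sum g        ≡⟨ ≡.cong₂ _+_ (∑≡sum f) (∑≡sum g) ⟨
    ∑ R f + ∑ R g            ∎

  ∑-comm : ∀ {m n} (f : Fin m → Fin n → Carrier) →
           ∑ R (λ i → ∑ R (f i)) ≈ ∑ R (λ j → ∑ R (λ i → f i j))
  ∑-comm f = begin
    ∑ R (λ i → ∑ R (f i))                ≡⟨ ∑≡sum² f ⟩
    S.sum (λ i → S.sum (f i))            ≈⟨ S.∑-comm f ⟩
    S.sum (λ j → S.sum (λ i → f i j))    ≡⟨ ∑≡sum² (λ j i → f i j) ⟨
    ∑ R (λ j → ∑ R (λ i → f i j))        ∎
    where
    ∑≡sum² : ∀ {a b} (g : Fin a → Fin b → Carrier) → ∑ R (λ i → ∑ R (g i)) ≡ S.sum (λ i → S.sum (g i))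
    ∑≡sum² g = ≡.trans (∑≡sum (λ i → ∑ R (g i))) (S.sum-cong-≗ (λ i → ∑≡sum (g i)))

  *-distribˡ-∑ : ∀ {n} x (f : Fin n → Carrier) → x * ∑ R f ≈ ∑ R (λ i → x * f i)
  *-distribˡ-∑ {zero}  x f = zeroʳ x
  *-distribˡ-∑ {suc n} x f = trans (distribˡ x _ _) (+-congˡ (*-distribˡ-∑ x (f ∘ fsuc)))

  *-distribʳ-∑ : ∀ {n} x (f : Fin n → Carrier) → ∑ R f * x ≈ ∑ R (λ i → f i * x)
  *-distribʳ-∑ {zero}  x f = zeroˡ x
  *-distribʳ-∑ {suc n} x f = trans (distribʳ x _ _) (+-congˡ (*-distribʳ-∑ x (f ∘ fsuc)))

  -‿distrib-∑ : ∀ {n} (f : Fin n → Carrier) → ∑ R (λ i → - f i) ≈ - ∑ R f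
  -‿distrib-∑ {zero}  f = sym RP.-0#≈0#
  -‿distrib-∑ {suc n} f = trans (+-congˡ (-‿distrib-∑ (f ∘ fsuc))) (RP.-‿+-comm _ _)

  δ : ∀ {k} → Fin k → Fin k → Carrier
  δ fzero    fzero    = 1#
  δ fzero    (fsuc _) = 0#
  δ (fsuc _) fzero    = 0#
  δ (fsuc r) (fsuc s) = δ r s

  ∑-δ : ∀ {k} (g : Fin k → Carrier) r → g r ≈ ∑ R (λ s → δ r s * g s)
  ∑-δ {suc k} g fzero = sym (begin
    1# * g fzero + ∑ R (λ s → 0# * g (fsuc s))  ≈⟨ +-cong (*-identityˡ _) (∑-cong (λ s → zeroˡ (g (fsuc s)))) ⟩
    g fzero + ∑ R {k} (λ _ → 0#)                 ≈⟨ +-congˡ (∑-zero k) ⟩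
    g fzero + 0#                                 ≈⟨ +-identityʳ _ ⟩
    g fzero                                      ∎)
  ∑-δ {suc k} g (fsuc r) = begin
    g (fsuc r)                                          ≈⟨ ∑-δ (g ∘ fsuc) r ⟩
    ∑ R (λ s → δ r s * g (fsuc s))                      ≈⟨ +-identityˡ _ ⟨
    0# + ∑ R (λ s → δ r s * g (fsuc s))                 ≈⟨ +-congʳ (zeroˡ (g fzero)) ⟨
    0# * g fzero + ∑ R (λ s → δ r s * g (fsuc s))       ∎

module Counting {c ℓ} {F : CommutativeRing c ℓ} {q : ℕ} (card : HasCard F q) where
  open CommutativeRing F
  open Inverse card
  open import Relation.Binary.Reasoning.Setoid setoid

  to-injective : ∀ {x y} → to x ≡ to y → x ≈ y
  to-injective {x} {y} e = begin
    x                ≈⟨ strictlyInverseʳ x ⟨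
    from (to x)      ≡⟨ ≡.cong from e ⟩
    from (to y)      ≈⟨ strictlyInverseʳ y ⟩
    y                ∎

  2≤card : ¬ (0# ≈ 1#) → 2 ≤ q
  2≤card 0≉1 = injective⇒≤ {f = bit} bit-injective
    where
    bit : Fin 2 → Fin q
    bit fzero    = to 0#
    bit (fsuc _) = to 1#
    bit-injective : ∀ {i j} → bit i ≡ bit j → i ≡ j
    bit-injective {fzero}      {fzero}      _ = ≡.refl
    bit-injective {fzero}      {fsuc fzero} e = ⊥-elim (0≉1 (to-injective e))
    bit-injective {fsuc fzero} {fzero}      e = ⊥-elim (0≉1 (to-injective (≡.sym e)))
    bit-injective {fsuc fzero} {fsuc fzero} _ = ≡.refl

  encode : ∀ {n} → (Fin n → Carrier) → Fin (q ^ n)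
  encode v = funToFin (to ∘ v)

  decode : ∀ {n} → Fin (q ^ n) → Fin n → Carrier
  decode k = from ∘ finToFun k

  encode-cong : ∀ {n} {v w : Fin n → Carrier} → (∀ i → v i ≈ w i) → encode v ≡ encode w
  encode-cong e = funToFin-cong (to-cong ∘ e)

  encode-injective : ∀ {n} {v w : Fin n → Carrier} → encode v ≡ encode w → ∀ i → v i ≈ w i
  encode-injective e = to-injective ∘ funToFin-injective e

  encode-decode : ∀ {n} (k : Fin (q ^ n)) → encode (decode {n} k) ≡ k
  encode-decode {n} k =
    ≡.trans (funToFin-cong {n} {q} (strictlyInverseˡ ∘ finToFun k)) (funToFin-finToFin {n} {q} k)

  retract⇒card-≤ : ∀ {n s m} (a : (Fin n → Carrier) → Fin s → Fin m → Carrier)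
    (Φ : (Fin s → Fin m → Carrier) → Fin n → Carrier) →
    (∀ {α β} → (∀ x y → α x y ≈ β x y) → ∀ i → Φ α i ≈ Φ β i) →
    (∀ v i → v i ≈ Φ (a v) i) → q ^ n ≤ (q ^ m) ^ s
  retract⇒card-≤ {n} a Φ Φ-cong Φ∘a≈id = injective⇒≤ {f = h} h-injective
    where
    h : Fin (q ^ n) → Fin _
    h k = funToFin (encode ∘ a (decode k))
    h-injective : ∀ {k k'} → h k ≡ h k' → k ≡ k'
    h-injective {k} {k'} e =
      ≡.trans (≡.sym (encode-decode {n} k)) (≡.trans (encode-cong decode-k≈decode-k') (encode-decode {n} k'))
      where
      a-equal : ∀ x y → a (decode k) x y ≈ a (decode k') x y
      a-equal x = encode-injective (funToFin-injective e x)
      decode-k≈decode-k' : ∀ i → decode k i ≈ decode k' i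
      decode-k≈decode-k' i = trans (Φ∘a≈id (decode k) i)
        (trans (Φ-cong a-equal i) (sym (Φ∘a≈id (decode k') i)))

module Coordinates {c ℓ c' ℓ'} {F : CommutativeRing c ℓ} {E : CommutativeRing c' ℓ'} {m : ℕ}
                   (X : Extension F E m) where
  private
    module F = CommutativeRing F
    module E = CommutativeRing E
    import Algebra.Properties.Ring E.ring as EP
    import Algebra.Properties.Ring F.ring as FP
  open Extension X
  open CommutativeRing E
  open Sums E
  open import Relation.Binary.Reasoning.Setoid setoid

  ι-0 : ι F.0# ≈ 0#
  ι-0 = EP.x+x≈x⇒x≈0 _ (trans (sym (ι-+ F.0# F.0#)) (ι-cong (F.+-identityˡ F.0#)))

  ι-neg : ∀ a → ι (F.- a) ≈ - ι a
  ι-neg a = EP.+-inverseˡ-unique (ι (F.- a)) (ι a)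
    (trans (sym (ι-+ _ _)) (trans (ι-cong (F.-‿inverseˡ a)) ι-0))

  ι-∑ : ∀ {n} (f : Fin n → F.Carrier) → ι (∑ F f) ≈ ∑ E (ι ∘ f)
  ι-∑ {zero}  f = ι-0
  ι-∑ {suc n} f = trans (ι-+ _ _) (+-congˡ (ι-∑ (f ∘ fsuc)))

  fromCoord : (Fin m → F.Carrier) → Carrier
  fromCoord a = ∑ E (λ j → ι (a j) * Γ j)

  fromCoord-‿ : ∀ a b → fromCoord (λ j → a j F.- b j) ≈ fromCoord a - fromCoord b
  fromCoord-‿ a b = begin
    fromCoord (λ j → a j F.- b j)                  ≈⟨ ∑-cong {m} (λ j → *-congʳ (trans (ι-+ _ _) (+-congˡ (ι-neg _)))) ⟩
    ∑ E (λ j → (ι (a j) - ι (b j)) * Γ j)          ≈⟨ ∑-cong {m} (λ j → trans (distribʳ _ _ _) (+-congˡ (sym (EP.-‿distribˡ-* _ _)))) ⟩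
    ∑ E (λ j → ι (a j) * Γ j - ι (b j) * Γ j)      ≈⟨ ∑-distrib-+ (λ j → ι (a j) * Γ j) (λ j → - (ι (b j) * Γ j)) ⟩
    fromCoord a + ∑ E (λ j → - (ι (b j) * Γ j))    ≈⟨ +-congˡ (-‿distrib-∑ (λ j → ι (b j) * Γ j)) ⟩
    fromCoord a - fromCoord b                      ∎

  fromCoord-injective : ∀ {a b} → fromCoord a ≈ fromCoord b → ∀ j → a j F.≈ b j
  fromCoord-injective {a} {b} e j = FP.x∙y⁻¹≈ε⇒x≈y _ _
    (indep (λ j → a j F.- b j) (trans (fromCoord-‿ a b) (EP.x≈y⇒x∙y⁻¹≈ε e)) j)

  coord-fromCoord : ∀ a j → coord (fromCoord a) j F.≈ a j
  coord-fromCoord a = fromCoord-injective (sym (expand (fromCoord a)))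

  coord-cong : ∀ {x y} → x ≈ y → ∀ j → coord x j F.≈ coord y j
  coord-cong e = fromCoord-injective (trans (sym (expand _)) (trans e (expand _)))

  coord-unique : ∀ {x a} → x ≈ fromCoord a → ∀ j → coord x j F.≈ a j
  coord-unique {a = a} e j = F.trans (coord-cong e j) (coord-fromCoord a j)

  ∑-fromCoord : ∀ {k} (a : Fin k → Fin m → F.Carrier) →
    ∑ E (λ r → fromCoord (a r)) ≈ fromCoord (λ j → ∑ F (λ r → a r j))
  ∑-fromCoord a = begin
    ∑ E (λ r → ∑ E (λ j → ι (a r j) * Γ j))     ≈⟨ ∑-comm (λ r j → ι (a r j) * Γ j) ⟩
    ∑ E (λ j → ∑ E (λ r → ι (a r j) * Γ j))     ≈⟨ ∑-cong {m} (λ j → *-distribʳ-∑ (Γ j) (λ r → ι (a r j))) ⟨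
    ∑ E (λ j → ∑ E (λ r → ι (a r j)) * Γ j)     ≈⟨ ∑-cong {m} (λ j → *-congʳ (ι-∑ (λ r → a r j))) ⟨
    fromCoord (λ j → ∑ F (λ r → a r j))         ∎

  coord-∑ : ∀ {k} (f : Fin k → Carrier) j → coord (∑ E f) j F.≈ ∑ F (λ r → coord (f r) j)
  coord-∑ f = coord-unique (trans (∑-cong (λ r → expand (f r))) (∑-fromCoord (λ r → coord (f r))))

  coord-* : ∀ u y j → coord (u * y) j F.≈ ∑ F (λ l → coord y l F.* coord (u * Γ l) j)
  coord-* u y = coord-unique (begin
    u * y                                                             ≈⟨ *-congˡ (expand y) ⟩
    u * fromCoord (coord y)                                           ≈⟨ *-distribˡ-∑ {m} u _ ⟩
    ∑ E (λ l → u * (ι (coord y l) * Γ l))                              ≈⟨ ∑-cong {m} (λ l → x*[y*z]≈y*[x*z] u _ _) ⟩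
    ∑ E (λ l → ι (coord y l) * (u * Γ l))                              ≈⟨ ∑-cong {m} (λ l → *-congˡ (expand (u * Γ l))) ⟩
    ∑ E (λ l → ι (coord y l) * fromCoord (coord (u * Γ l)))            ≈⟨ ∑-cong {m} (λ l → *-distribˡ-∑ {m} (ι (coord y l)) _) ⟩
    ∑ E (λ l → ∑ E (λ j → ι (coord y l) * (ι (coord (u * Γ l) j) * Γ j)))
      ≈⟨ ∑-cong {m} (λ l → ∑-cong {m} (λ j → trans (sym (*-assoc _ _ _)) (*-congʳ (sym (ι-* _ _))))) ⟩
    ∑ E (λ l → fromCoord (λ j → coord y l F.* coord (u * Γ l) j))     ≈⟨ ∑-fromCoord (λ l j → coord y l F.* coord (u * Γ l) j) ⟩
    fromCoord (λ j → ∑ F (λ l → coord y l F.* coord (u * Γ l) j))     ∎)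
    where
    x*[y*z]≈y*[x*z] : ∀ x y z → x * (y * z) ≈ y * (x * z)
    x*[y*z]≈y*[x*z] x y z = trans (sym (*-assoc x y z)) (trans (*-congʳ (*-comm x y)) (*-assoc y x z))

module Supports {c ℓ c' ℓ'} {F : CommutativeRing c ℓ} {E : CommutativeRing c' ℓ'} {m : ℕ}
                (X : Extension F E m) where
  private
    module E = CommutativeRing E
  open Extension X
  open Coordinates X
  open CommutativeRing F
  open Sums F
  open import Relation.Binary.Reasoning.Setoid setoid

  Γmat·vec : ∀ {n} → (Fin n → E.Carrier) → (Fin m → Carrier) → Fin n → Carrier
  Γmat·vec x a i = ∑ F (λ j → a j * Γmat X x i j)

  InSumOfSupps : ∀ {n t} → (Fin t → Fin n → E.Carrier) → (Fin n → Carrier) → Set _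
  InSumOfSupps {n} {t} xs v = Σ (Fin t → Fin n → Carrier) λ w →
    (∀ s → supp X (xs s) (w s)) × (∀ i → v i ≈ ∑ F (λ s → w s i))

  Γmat·vec-∑ˡ : ∀ {n t} (x : Fin n → E.Carrier) (a : Fin t → Fin m → Carrier) i →
    ∑ F (λ s → Γmat·vec x (a s) i) ≈ Γmat·vec x (λ j → ∑ F (λ s → a s j)) i
  Γmat·vec-∑ˡ x a i = begin
    ∑ F (λ s → ∑ F (λ j → a s j * Γmat X x i j))   ≈⟨ ∑-comm (λ s j → a s j * Γmat X x i j) ⟩
    ∑ F (λ j → ∑ F (λ s → a s j * Γmat X x i j))   ≈⟨ ∑-cong {m} (λ j → *-distribʳ-∑ (Γmat X x i j) (λ s → a s j)) ⟨
    Γmat·vec x (λ j → ∑ F (λ s → a s j)) i         ∎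

  Γmat·vec-∑ʳ : ∀ {n t} {x : Fin n → E.Carrier} (y : Fin t → Fin n → E.Carrier) →
    (∀ i → x i E.≈ ∑ E (λ s → y s i)) → ∀ a i → Γmat·vec x a i ≈ ∑ F (λ s → Γmat·vec (y s) a i)
  Γmat·vec-∑ʳ {t = t} {x} y x≈∑y a i = begin
    ∑ F (λ j → a j * coord (x i) j)                        ≈⟨ ∑-cong {m} (λ j → *-congˡ (trans (coord-cong (x≈∑y i) j) (coord-∑ (λ s → y s i) j))) ⟩
    ∑ F (λ j → a j * ∑ F (λ s → coord (y s i) j))          ≈⟨ ∑-cong {m} (λ j → *-distribˡ-∑ (a j) (λ s → coord (y s i) j)) ⟩
    ∑ F (λ j → ∑ F (λ s → a j * coord (y s i) j))          ≈⟨ ∑-comm (λ j s → a j * coord (y s i) j) ⟩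
    ∑ F (λ s → Γmat·vec (y s) a i)                         ∎

  mulCoeffs : E.Carrier → (Fin m → Carrier) → Fin m → Carrier
  mulCoeffs u a l = ∑ F (λ j → a j * coord (u E.* Γ l) j)

  Γmat·vec-* : ∀ {n} u (y : Fin n → E.Carrier) a i →
    Γmat·vec (λ i → u E.* y i) a i ≈ Γmat·vec y (mulCoeffs u a) i
  Γmat·vec-* u y a i = begin
    ∑ F (λ j → a j * coord (u E.* y i) j)                         ≈⟨ ∑-cong {m} (λ j → *-congˡ (coord-* u (y i) j)) ⟩
    ∑ F (λ j → a j * ∑ F (λ l → C l * D l j))                     ≈⟨ ∑-cong {m} (λ j → *-distribˡ-∑ (a j) (λ l → C l * D l j)) ⟩
    ∑ F (λ j → ∑ F (λ l → a j * (C l * D l j)))                   ≈⟨ ∑-comm (λ j l → a j * (C l * D l j)) ⟩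
    ∑ F (λ l → ∑ F (λ j → a j * (C l * D l j)))                   ≈⟨ ∑-cong {m} (λ l → ∑-cong {m} (λ j → x*[y*z]≈[x*z]*y (a j) (C l) (D l j))) ⟩
    ∑ F (λ l → ∑ F (λ j → (a j * D l j) * C l))                   ≈⟨ ∑-cong {m} (λ l → *-distribʳ-∑ (C l) (λ j → a j * D l j)) ⟨
    Γmat·vec y (mulCoeffs u a) i                                  ∎
    where
    C : Fin m → Carrier
    C l = coord (y i) l
    D : Fin m → Fin m → Carrier
    D l j = coord (u E.* Γ l) j
    x*[y*z]≈[x*z]*y : ∀ x y z → x * (y * z) ≈ (x * z) * y
    x*[y*z]≈[x*z]*y x y z = trans (*-congˡ (*-comm y z)) (sym (*-assoc x z y))

  supp-∑ : ∀ {n t} {x : Fin n → E.Carrier} {w : Fin t → Fin n → Carrier} →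
    (∀ s → supp X x (w s)) → supp X x (λ i → ∑ F (λ s → w s i))
  supp-∑ {t = t} {x} w∈ = (λ j → ∑ F (λ s → proj₁ (w∈ s) j)) , λ i →
    trans (∑-cong {t} (λ s → proj₂ (w∈ s) i)) (Γmat·vec-∑ˡ x (proj₁ ∘ w∈) i)

  supp-⊆-rows : ∀ {k n} {G : Fin k → Fin n → E.Carrier} {x v} →
    InRowSpace E G x → supp X x v → InSumOfSupps G v
  supp-⊆-rows {G = G} {x} {v} (u , x≈uG) (a , v≈Γx·a) =
    (λ r → Γmat·vec (G r) (mulCoeffs (u r) a)) , (λ r → mulCoeffs (u r) a , λ _ → refl) , λ i → begin
      v i                                                    ≈⟨ v≈Γx·a i ⟩
      Γmat·vec x a i                                         ≈⟨ Γmat·vec-∑ʳ (λ r i → u r E.* G r i) x≈uG a i ⟩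
      ∑ F (λ r → Γmat·vec (λ i → u r E.* G r i) a i)         ≈⟨ ∑-cong (λ r → Γmat·vec-* (u r) (G r) a i) ⟩
      ∑ F (λ r → Γmat·vec (G r) (mulCoeffs (u r) a) i)       ∎

  InSumOfSupps-∑ : ∀ {k n t} {G : Fin k → Fin n → E.Carrier} {v} {w : Fin t → Fin n → Carrier} →
    (∀ i → v i ≈ ∑ F (λ s → w s i)) → (∀ s → InSumOfSupps G (w s)) → InSumOfSupps G v
  InSumOfSupps-∑ {t = t} {v = v} {w} v≈∑w w∈ =
    (λ r i → ∑ F (λ s → W s r i)) , (λ r → supp-∑ (λ s → proj₁ (proj₂ (w∈ s)) r)) , λ i → begin
      v i                                    ≈⟨ v≈∑w i ⟩
      ∑ F (λ s → w s i)                      ≈⟨ ∑-cong {t} (λ s → proj₂ (proj₂ (w∈ s)) i) ⟩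
      ∑ F (λ s → ∑ F (λ r → W s r i))        ≈⟨ ∑-comm (λ s r → W s r i) ⟩
      ∑ F (λ r → ∑ F (λ s → W s r i))        ∎
    where
    W = λ s → proj₁ (w∈ s)

  rows-inRowSpace : ∀ {k n} (G : Fin k → Fin n → E.Carrier) r → InRowSpace E G (G r)
  rows-inRowSpace G r = Sums.δ E r , λ i → Sums.∑-δ E (λ s → G s i) r

  spannedBy-rows : ∀ {k n t} {G : Fin k → Fin n → E.Carrier} → SpannedBy X G t → SpannedBy X G k
  spannedBy-rows {G = G} (xs , xs∈C , span) = G , rows-inRowSpace G , λ v →
    let (w , w∈supp , v≈∑w) = span v
    in InSumOfSupps-∑ v≈∑w (λ s → supp-⊆-rows (xs∈C s) (w∈supp s))

  suppsSpan⇒card-≤ : ∀ {q n s} → HasCard F q → {xs : Fin s → Fin n → E.Carrier} →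
    SuppsSpan X xs → q ^ n ≤ (q ^ m) ^ s
  suppsSpan⇒card-≤ {n = n} {s} card {xs} span =
    Counting.retract⇒card-≤ {F = F} card coeffs Φ Φ-cong Φ∘coeffs≈id
    where
    coeffs : (Fin n → Carrier) → Fin s → Fin m → Carrier
    coeffs v t = proj₁ (proj₁ (proj₂ (span v)) t)
    Φ : (Fin s → Fin m → Carrier) → Fin n → Carrier
    Φ α i = ∑ F (λ t → Γmat·vec (xs t) (α t) i)
    Φ-cong : ∀ {α β} → (∀ t j → α t j ≈ β t j) → ∀ i → Φ α i ≈ Φ β i
    Φ-cong α≈β i = ∑-cong {s} (λ t → ∑-cong {m} (λ j → *-congʳ (α≈β t j)))
    Φ∘coeffs≈id : ∀ v i → v i ≈ Φ (coeffs v) i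
    Φ∘coeffs≈id v i = trans (proj₂ (proj₂ (span v)) i) (∑-cong {s} (λ t → proj₂ (proj₁ (proj₂ (span v)) t) i))

-- Imported only here, where it no longer clashes with ring multiplication.
open import Data.Nat using (_*_)

q^mk≤[q^m]^s⇒k≤s : ∀ {q m k s} → 2 ≤ q → 1 ≤ m → q ^ (m * k) ≤ (q ^ m) ^ s → k ≤ s
q^mk≤[q^m]^s⇒k≤s {q} {m@(suc _)} {k} {s} 2≤q _ le = ≮⇒≥ λ s<k →
  <⇒≱ (^-monoʳ-< q 2≤q (*-monoʳ-< m s<k)) (≡.subst (q ^ (m * k) ≤_) (^-*-assoc q m s) le)

corollary5p14 : ∀ {c ℓ c' ℓ'} (q m k : ℕ) → IsPrimePower q → 2 ≤ m → 2 ≤ k →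
    (F : CommutativeRing c ℓ) → IsField F → HasCard F q →
    (E : CommutativeRing c' ℓ') → IsField E → (X : Extension F E m) →
    (G : Fin k → Fin (m * k) → CommutativeRing.Carrier E) →
    RowsIndependent E G → NonDegenerate X G →
    CritIs X G k
corollary5p14 q m k _ m≥2 (s≤s _) F F-field card E _ X G _ (_ , spanned) =
  s≤s z≤n , Supports.spannedBy-rows X {G = G} spanned , minimal
  where
  minimal : ∀ s → 1 ≤ s → SpannedBy X G s → k ≤ s
  minimal s _ (_ , _ , span) =
    q^mk≤[q^m]^s⇒k≤s (Counting.2≤card {F = F} card (IsField.0≉1 F-field)) (≤-trans (s≤s z≤n) m≥2)
      (Supports.suppsSpan⇒card-≤ X card span)
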